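{- Let $\mathcal R$ be a TRS, $\mu$ a replacement map, $s,t$ terms and $\sigma$ a substitution. If $s\sigma\in\mathcal T(\mu)$ and $\mathrm{CAP}^s_\mu(t)=t$, then $t\sigma\in\mathrm{NF}(\mathcal R)$.
   Context: $\mathcal R$ is a TRS over a finite signature; $\mathrm{NF}(\mathcal R)$ its set of normal forms. A replacement map $\mu$ assigns to each $n$-ary $f$ a set $\mu(f)\subseteq\{1,\dots,n\}$. $\mathrm{Pos}_\mu(x)=\{\epsilon\}$ for variables, $\mathrm{Pos}_\mu(f(t_1,\dots,t_n))=\{\epsilon\}\cup\{ip\mid i\in\mu(f),p\in\mathrm{Pos}_\mu(t_i)\}$, $\mathrm{NPos}_\mu(t)=\mathrm{Pos}(t)\setminus\mathrm{Pos}_\mu(t)$. $\mathcal T(\mu)$ is the set of terms $u$ such that for all positions $p$ of $u$, $u|_p\notin\mathrm{NF}(\mathcal R)$ implies $p\in\mathrm{Pos}_\mu(u)$. $\mathrm{CAP}^s_\mu(t)$ is defined recursively on $t$: it is $t$ if $t=s|_p$ for some $p\in\mathrm{NPos}_\mu(s)$; otherwise, if $t=f(t_1,\dots,t_n)$ and $u=f(\mathrm{CAP}^s_\mu(t_1),\dots,\mathrm{CAP}^s_\mu(t_n))$ unifies with no left-hand side of $\mathcal R$ (renamed apart from $u$), it is $u$; in all other cases it is a fresh variable. -}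

module Defs where

open import Data.Nat using (ℕ; zero; suc; _⊔_)
open import Data.Fin using (Fin; toℕ)
open import Data.Fin.Subset using (Subset; _∈_)
open import Data.Vec using (Vec; []; _∷_; lookup; _[_]≔_)
open import Data.List using (List; []; _∷_)
open import Data.Product using (Σ; ∃; _×_)
open import Relation.Binary.PropositionalEquality using (_≡_)
open import Relation.Nullary using (¬_)

record Signature : Set where
  field
    nsym  : ℕ
    arity : Fin nsym → ℕ
open Signature public

data Term (F : Signature) : Set where
  var : ℕ → Term F
  fun : (f : Fin (nsym F)) → Vec (Term F) (arity F f) → Term F

module _ {F : Signature} where

  Subst : Set
  Subst = ℕ → Term F

  mutual
    _⟨_⟩ : Term F → Subst → Term F
    var x    ⟨ σ ⟩ = σ x
    fun f ts ⟨ σ ⟩ = fun f (ts ⟨ σ ⟩*)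

    _⟨_⟩* : ∀ {n} → Vec (Term F) n → Subst → Vec (Term F) n
    []       ⟨ σ ⟩* = []
    (t ∷ ts) ⟨ σ ⟩* = (t ⟨ σ ⟩) ∷ (ts ⟨ σ ⟩*)

  mutual
    maxVar : Term F → ℕ
    maxVar (var x)    = x
    maxVar (fun f ts) = maxVar* ts

    maxVar* : ∀ {n} → Vec (Term F) n → ℕ
    maxVar* []       = 0
    maxVar* (t ∷ ts) = maxVar t ⊔ maxVar* ts

  -- Positions are lists of (0-based) argument indices.
  -- t ∣ p ≡ u  means  p ∈ Pos(t) and t|_p = u.

  Position : Set
  Position = List ℕ

  data _∣_≡ₜ_ : Term F → Position → Term F → Set where
    here  : ∀ {t} → t ∣ [] ≡ₜ t
    there : ∀ {f ts p u} (i : Fin (arity F f)) →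
            lookup ts i ∣ p ≡ₜ u → fun f ts ∣ (toℕ i ∷ p) ≡ₜ u

  -- Term rewriting systems: a (possibly infinite) set of rules l → r.

  TRS : Set₁
  TRS = Term F → Term F → Set

  data Step (R : TRS) : Term F → Term F → Set where
    root : ∀ {l r} (σ : Subst) → R l r → Step R (l ⟨ σ ⟩) (r ⟨ σ ⟩)
    cong : ∀ {f ts u} (i : Fin (arity F f)) → Step R (lookup ts i) u →
           Step R (fun f ts) (fun f (ts [ i ]≔ u))

  NF : TRS → Term F → Set
  NF R t = ∀ u → ¬ Step R t u

  ReplacementMap : Set
  ReplacementMap = (f : Fin (nsym F)) → Subset (arity F f)

  data MuPos (μ : ReplacementMap) : Term F → Position → Set where
    here  : ∀ {t} → MuPos μ t []
    there : ∀ {f ts p} (i : Fin (arity F f)) → i ∈ μ f →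
            MuPos μ (lookup ts i) p → MuPos μ (fun f ts) (toℕ i ∷ p)

  NPos : ReplacementMap → Term F → Position → Set
  NPos μ t p = (∃ λ u → t ∣ p ≡ₜ u) × ¬ MuPos μ t p

  InT : TRS → ReplacementMap → Term F → Set
  InT R μ u = ∀ p v → u ∣ p ≡ₜ v → ¬ NF R v → MuPos μ u p

  -- u unifies with l, l renamed apart from u (a pair of substitutions).
  Unifiable : Term F → Term F → Set
  Unifiable u l = ∃ λ (θ₁ : Subst) → ∃ λ (θ₂ : Subst) → (u ⟨ θ₁ ⟩) ≡ (l ⟨ θ₂ ⟩)

  NoLhsUnifies : TRS → Term F → Set
  NoLhsUnifies R u = ∀ l r → R l r → ¬ Unifiable u l

  IsNPosSubterm : ReplacementMap → Term F → Term F → Set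
  IsNPosSubterm μ s t = ∃ λ p → s ∣ p ≡ₜ t × ¬ MuPos μ s p

  -- Cap R μ s k t u k' : CAP^s_μ(t) = u, where fresh variables are drawn
  -- from a counter starting at k and ending at k' (so distinct fresh
  -- variables are used for distinct occurrences).
  mutual
    data Cap (R : TRS) (μ : ReplacementMap) (s : Term F) :
             ℕ → Term F → Term F → ℕ → Set where
      cap-npos  : ∀ {k t} → IsNPosSubterm μ s t → Cap R μ s k t t k
      cap-fun   : ∀ {k k' f ts us} → ¬ IsNPosSubterm μ s (fun f ts) →
                  Caps R μ s k ts us k' → NoLhsUnifies R (fun f us) →
                  Cap R μ s k (fun f ts) (fun f us) k'
      cap-var   : ∀ {k x} → ¬ IsNPosSubterm μ s (var x) →
                  Cap R μ s k (var x) (var k) (suc k)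
      cap-fresh : ∀ {k k' f ts us} → ¬ IsNPosSubterm μ s (fun f ts) →
                  Caps R μ s k ts us k' → ¬ NoLhsUnifies R (fun f us) →
                  Cap R μ s k (fun f ts) (var k') (suc k')

    data Caps (R : TRS) (μ : ReplacementMap) (s : Term F) :
              ∀ {n} → ℕ → Vec (Term F) n → Vec (Term F) n → ℕ → Set where
      []  : ∀ {k} → Caps R μ s k [] [] k
      _∷_ : ∀ {n k k' k'' t u} {ts us : Vec (Term F) n} →
            Cap R μ s k t u k' → Caps R μ s k' ts us k'' →
            Caps R μ s k (t ∷ ts) (u ∷ us) k''

  -- CAP^s_μ(t) = u, fresh variables being larger than every variable of s, t.
  CAP : TRS → ReplacementMap → Term F → Term F → Term F → Set
  CAP R μ s t u = Σ ℕ λ k' → Cap R μ s (suc (maxVar s ⊔ maxVar t)) t u k'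

-- If CAP^s_μ(t) = t, then no subterm of t was replaced by a fresh variable, so every
-- subterm of t either is a non-replacing subterm of s or is a non-variable term
-- unifying with no left-hand side.  Instances of the former are normal forms because
-- sσ ∈ 𝒯(μ) and the position stays non-replacing in sσ; instances of the latter are
-- no redex at the root, and by induction not below it either.
module Submission where

open import Defs
open import Data.Nat using (_≤_; _<_; s≤s)
open import Data.Nat.Properties using (≤-refl; ≤-trans; n≤1+n; m≤m⊔n; m≤n⊔m; <-irrefl)
open import Data.Fin using (Fin; toℕ; zero; suc)
open import Data.Fin.Properties using (toℕ-injective)
open import Data.Fin.Subset using (_∈_)
open import Data.Vec using (Vec; []; _∷_; lookup)
open import Data.List using (_∷_)
open import Data.List.Properties using (∷-injective)
open import Data.Product using (_×_; _,_)
open import Data.Empty using (⊥; ⊥-elim)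
open import Relation.Binary.PropositionalEquality using (_≡_; refl; sym; subst)

module _ {F : Signature} where

  lookup-⟨⟩* : ∀ {n} (ts : Vec (Term F) n) (i : Fin n) (σ : Subst {F}) →
               lookup (ts ⟨ σ ⟩*) i ≡ lookup ts i ⟨ σ ⟩
  lookup-⟨⟩* (t ∷ ts) zero    σ = refl
  lookup-⟨⟩* (t ∷ ts) (suc i) σ = lookup-⟨⟩* ts i σ

  ∣≡ₜ-⟨⟩ : ∀ {s p t} (σ : Subst {F}) → s ∣ p ≡ₜ t → (s ⟨ σ ⟩) ∣ p ≡ₜ (t ⟨ σ ⟩)
  ∣≡ₜ-⟨⟩ σ here = here
  ∣≡ₜ-⟨⟩ σ (there {ts = ts} i sub) =
    there i (subst (_∣ _ ≡ₜ _) (sym (lookup-⟨⟩* ts i σ)) (∣≡ₜ-⟨⟩ σ sub))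

  module _ {μ : ReplacementMap {F}} where

    MuPos-there⁻ : ∀ {f ts p} {i : Fin (arity F f)} →
                   MuPos μ (fun f ts) (toℕ i ∷ p) → i ∈ μ f × MuPos μ (lookup ts i) p
    MuPos-there⁻ mp = invert mp refl refl
      where
      invert : ∀ {f ts p a q} {i : Fin (arity F f)} → MuPos μ a q →
               a ≡ fun f ts → q ≡ toℕ i ∷ p → i ∈ μ f × MuPos μ (lookup ts i) p
      invert (there j j∈μ mp) refl eq with ∷-injective eq
      ... | toℕj≡toℕi , refl with toℕ-injective toℕj≡toℕi
      ... | refl = j∈μ , mp

    -- Only positions of s itself are meant: below a variable of s, Pos_μ(sσ) is
    -- governed by σ instead.
    MuPos-⟨⟩⁻ : ∀ {s p t} (σ : Subst {F}) → s ∣ p ≡ₜ t → MuPos μ (s ⟨ σ ⟩) p → MuPos μ s p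
    MuPos-⟨⟩⁻ σ here mp = here
    MuPos-⟨⟩⁻ σ (there {ts = ts} {p = p} i sub) mp
      with i∈μ , mp′ ← MuPos-there⁻ {ts = ts ⟨ σ ⟩*} mp =
      there i i∈μ (MuPos-⟨⟩⁻ σ sub (subst (λ u → MuPos μ u p) (lookup-⟨⟩* ts i σ) mp′))

  NF-⟨⟩-NPos : ∀ (R : TRS {F}) μ {s t} (σ : Subst {F}) →
               InT R μ (s ⟨ σ ⟩) → IsNPosSubterm μ s t → NF R (t ⟨ σ ⟩)
  NF-⟨⟩-NPos R μ {t = t} σ sσ∈𝒯 (p , sub , p∉Posμ) u step =
    p∉Posμ (MuPos-⟨⟩⁻ σ sub (sσ∈𝒯 p (t ⟨ σ ⟩) (∣≡ₜ-⟨⟩ σ sub) (λ nf → nf u step)))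

  NF-⟨⟩-fun : ∀ (R : TRS {F}) (σ : Subst {F}) {f} (ts : Vec (Term F) (arity F f)) →
              NoLhsUnifies R (fun f ts) → (∀ i → NF R (lookup ts i ⟨ σ ⟩)) →
              NF R (fun f ts ⟨ σ ⟩)
  NF-⟨⟩-fun R σ {f} ts noLhs args-NF u step = noStep step refl
    where
    noStep : ∀ {a b} → Step R a b → a ≡ fun f (ts ⟨ σ ⟩*) → ⊥
    noStep (root θ lr)  eq   = noLhs _ _ lr (σ , θ , sym eq)
    noStep (cong i st) refl = args-NF i _ (subst (λ a → Step R a _) (lookup-⟨⟩* ts i σ) st)

  module _ {R : TRS {F}} {μ : ReplacementMap {F}} {s : Term F} where

    mutual
      Cap-counter-≤ : ∀ {k t u k′} → Cap R μ s k t u k′ → k ≤ k′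
      Cap-counter-≤ (cap-npos _)        = ≤-refl
      Cap-counter-≤ (cap-fun _ cs _)    = Caps-counter-≤ cs
      Cap-counter-≤ (cap-var _)         = n≤1+n _
      Cap-counter-≤ (cap-fresh _ cs _)  = ≤-trans (Caps-counter-≤ cs) (n≤1+n _)

      Caps-counter-≤ : ∀ {n k k′} {ts us : Vec (Term F) n} → Caps R μ s k ts us k′ → k ≤ k′
      Caps-counter-≤ []       = ≤-refl
      Caps-counter-≤ (c ∷ cs) = ≤-trans (Cap-counter-≤ c) (Caps-counter-≤ cs)

    -- The bound maxVar t < k rules out cap-var: a variable of t is never the fresh
    -- variable replacing it.
    mutual
      Cap-fixed⇒NF : ∀ {k t k′} (σ : Subst {F}) → InT R μ (s ⟨ σ ⟩) →
                     Cap R μ s k t t k′ → maxVar t < k → NF R (t ⟨ σ ⟩)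
      Cap-fixed⇒NF σ sσ∈𝒯 (cap-npos npos)           _ = NF-⟨⟩-NPos R μ σ sσ∈𝒯 npos
      Cap-fixed⇒NF σ sσ∈𝒯 (cap-fun {ts = ts} _ cs noLhs) t<k =
        NF-⟨⟩-fun R σ ts noLhs (Caps-fixed⇒NF σ sσ∈𝒯 cs t<k)
      Cap-fixed⇒NF σ sσ∈𝒯 (cap-var _)               k<k = ⊥-elim (<-irrefl refl k<k)

      Caps-fixed⇒NF : ∀ {n k k′} {ts : Vec (Term F) n} (σ : Subst {F}) → InT R μ (s ⟨ σ ⟩) →
                      Caps R μ s k ts ts k′ → maxVar* ts < k → ∀ i → NF R (lookup ts i ⟨ σ ⟩)
      Caps-fixed⇒NF σ sσ∈𝒯 (_∷_ {t = t} {ts = ts} c cs) t∷ts<k zero =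
        Cap-fixed⇒NF σ sσ∈𝒯 c (≤-trans (s≤s (m≤m⊔n (maxVar t) (maxVar* ts))) t∷ts<k)
      Caps-fixed⇒NF σ sσ∈𝒯 (_∷_ {t = t} {ts = ts} c cs) t∷ts<k (suc i) =
        Caps-fixed⇒NF σ sσ∈𝒯 cs ts<k′ i
        where
        ts<k′ : maxVar* ts < _
        ts<k′ = ≤-trans (≤-trans (s≤s (m≤n⊔m (maxVar t) (maxVar* ts))) t∷ts<k) (Cap-counter-≤ c)

lemma12 : {F : Signature} (R : TRS {F}) (μ : ReplacementMap {F})
          (s t : Term F) (σ : Subst {F}) →
          InT R μ (s ⟨ σ ⟩) → CAP R μ s t t → NF R (t ⟨ σ ⟩)
lemma12 R μ s t σ sσ∈𝒯 (_ , cap) = Cap-fixed⇒NF σ sσ∈𝒯 cap (s≤s (m≤n⊔m (maxVar s) (maxVar t)))
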